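{- Let $w$ be a p-string having a period $p$ with $p\le\frac{|w|}{|\Pi_w|+1}$. Then there exists exactly one character $a\in\Sigma\cup\Pi$ such that $p$ is a period of the p-string $wa$.
   Context: Let $\Sigma$ and $\Pi$ be disjoint alphabets; a p-string is a string over $\Sigma\cup\Pi$, indexed from 0, with $w[i:j]=w[i]\cdots w[j-1]$. A permutation $f$ of $\Pi$ acts on p-strings letterwise, fixing letters of $\Sigma$; $x\equiv y$ iff $f(x)=y$ for some permutation $f$ of $\Pi$. For $p\in\mathbb{N}^+$, $p\le|w|$, $p$ is a period of $w$ iff $w[0:|w|-p]\equiv w[p:|w|]$. $\Pi_w$ is the set of parameter characters occurring in $w$; $wa$ denotes concatenation. -}

module Defs where

open import Data.Nat using (ℕ; _≤_; _∸_; _*_; _+_; suc)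
open import Data.List using (List; length; take; drop; mapMaybe; deduplicate; map)
open import Data.Sum using (_⊎_; inj₁; inj₂)
import Data.Sum as Sum
open import Data.Maybe using (Maybe; just; nothing)
open import Data.Product using (∃; _×_)
open import Function using (id)
open import Function.Bundles using (_↔_; Inverse)
open import Relation.Binary.PropositionalEquality using (_≡_)
open import Relation.Binary.Definitions using (DecidableEquality)

Char : Set → Set → Set
Char Σ Π = Σ ⊎ Π

PString : Set → Set → Set
PString Σ Π = List (Char Σ Π)

act : {Σ Π : Set} → (Π ↔ Π) → PString Σ Π → PString Σ Π
act f = map (Sum.map id (Inverse.to f))

_≡ₚ_ : {Σ Π : Set} → PString Σ Π → PString Σ Π → Set
_≡ₚ_ {Σ} {Π} x y = ∃ λ (f : Π ↔ Π) → act f x ≡ y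

slice : {A : Set} → List A → ℕ → ℕ → List A
slice w i j = take (j ∸ i) (drop i w)

IsPeriod : {Σ Π : Set} → ℕ → PString Σ Π → Set
IsPeriod p w = (1 ≤ p) × (p ≤ length w) ×
  (slice w 0 (length w ∸ p) ≡ₚ slice w p (length w))

params : {Σ Π : Set} → PString Σ Π → List Π
params = mapMaybe λ { (inj₁ _) → nothing ; (inj₂ b) → just b }

paramSet : {Σ Π : Set} → DecidableEquality Π → PString Σ Π → List Π
paramSet _≟_ w = deduplicate _≟_ (params w)

numParams : {Σ Π : Set} → DecidableEquality Π → PString Σ Π → ℕ
numParams _≟_ w = length (paramSet _≟_ w)

{-# OPTIONS --safe #-}
-- Let f witness the period p of w, m = |w| - p and x = w[m]; then f(x) extends the period.
-- Any witness g of the period p of wb satisfies g(w[0:m]) = w[p:|w|] = f(w[0:m]) and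
-- g(x) = b, so b = f(x) is forced as soon as g and f agree on x; this is clear for x ∈ Σ
-- and holds for x ∈ Π once x occurs in w[0:m]. For the latter, look at the k+1 positions
-- m - p·k, …, m - p, m, where k = |Π_w|: along them w steps by f, so all of them carry
-- parameters; two of them carry the same one by pigeonhole, and shifting that repetition
-- to the right end finds x at a position below m.
module Submission where

open import Defs
open import Data.Nat using (ℕ; zero; suc; _≤_; _<_; _*_; _+_; _∸_; s≤s; s≤s⁻¹; z<s; NonZero; >-nonZero)
open import Data.Nat.Properties
open import Data.List using (List; []; _∷_; _++_; [_]; _∷ʳ_; length; take; drop; map; lookup)
open import Data.List.Properties using (map-++; length-++; length-map; length-drop; take-all; ∷-injectiveˡ; ∷-injectiveʳ; ∷ʳ-injective)
open import Data.List.Membership.Propositional using (_∈_)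
open import Data.List.Membership.Propositional.Properties using (∈-map⁺; ∈-deduplicate⁺)
open import Data.List.Relation.Unary.Any using (here; there; index)
open import Data.List.Relation.Unary.Any.Properties using (lookup-index)
open import Data.Maybe using (Maybe; just; nothing)
import Data.Maybe as Maybe
open import Data.Sum using (inj₁; inj₂)
import Data.Sum as Sum
open import Data.Product using (∃; ∃₂; _×_; _,_)
open import Data.Fin using (Fin; toℕ)
open import Data.Fin.Properties using (pigeonhole; toℕ<n)
open import Function using (id; _∘_)
open import Function.Bundles using (_↔_; Inverse)
open import Relation.Binary.PropositionalEquality using (_≡_; refl; sym; trans; cong; subst; module ≡-Reasoning)
open import Relation.Binary.Definitions using (DecidableEquality)
open import Algebra.Properties.CommutativeSemigroup +-commutativeSemigroup using (x∙yz≈y∙xz)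

private
  variable
    A B : Set
    Σ Π : Set

infixl 9 _!_
_!_ : List A → ℕ → Maybe A
[]       ! _     = nothing
(x ∷ xs) ! zero  = just x
(x ∷ xs) ! suc i = xs ! i

!-take : (xs : List A) {m i : ℕ} → i < m → take m xs ! i ≡ xs ! i
!-take []       {zero}          _         = refl
!-take []       {suc m}         _         = refl
!-take (x ∷ xs) {suc m} {zero}  _         = refl
!-take (x ∷ xs) {suc m} {suc i} (s≤s i<m) = !-take xs i<m

!-drop : (xs : List A) (p i : ℕ) → drop p xs ! i ≡ xs ! (p + i)
!-drop xs       zero    i = refl
!-drop []       (suc p) i = refl
!-drop (x ∷ xs) (suc p) i = !-drop xs p i

!-map : (g : A → B) (xs : List A) (i : ℕ) → map g xs ! i ≡ Maybe.map g (xs ! i)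
!-map g []       i       = refl
!-map g (x ∷ xs) zero    = refl
!-map g (x ∷ xs) (suc i) = !-map g xs i

!⇒∈ : (xs : List A) (i : ℕ) {x : A} → xs ! i ≡ just x → x ∈ xs
!⇒∈ (y ∷ xs) zero    refl = here refl
!⇒∈ (y ∷ xs) (suc i) eq   = there (!⇒∈ xs i eq)

<-length⇒!-defined : (xs : List A) {i : ℕ} → i < length xs → ∃ λ x → xs ! i ≡ just x
<-length⇒!-defined (x ∷ xs) {zero}  _         = x , refl
<-length⇒!-defined (x ∷ xs) {suc i} (s≤s i<n) = <-length⇒!-defined xs i<n

take-suc-++ : (xs : List A) (m : ℕ) {x : A} (ys : List A) →
  xs ! m ≡ just x → take (suc m) (xs ++ ys) ≡ take m xs ∷ʳ x
take-suc-++ (y ∷ xs) zero    ys refl = refl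
take-suc-++ (y ∷ xs) (suc m) ys eq   = cong (y ∷_) (take-suc-++ xs m ys eq)

drop-++ˡ : (xs : List A) {p : ℕ} (ys : List A) → p ≤ length xs → drop p (xs ++ ys) ≡ drop p xs ++ ys
drop-++ˡ xs       {zero}  ys _         = refl
drop-++ˡ (x ∷ xs) {suc p} ys (s≤s p≤n) = drop-++ˡ xs ys p≤n

length-∷ʳ-∸ : (xs : List A) (x : A) {p : ℕ} → p ≤ length xs → length (xs ∷ʳ x) ∸ p ≡ suc (length xs ∸ p)
length-∷ʳ-∸ xs x {p} p≤n = begin
  length (xs ++ [ x ]) ∸ p ≡⟨ cong (_∸ p) (trans (length-++ xs) (+-comm (length xs) 1)) ⟩
  suc (length xs) ∸ p      ≡⟨ +-∸-assoc 1 p≤n ⟩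
  suc (length xs ∸ p)      ∎
  where open ≡-Reasoning

map-≡⇒≡-on-∈ : (g h : A → B) (xs : List A) → map g xs ≡ map h xs → ∀ {x} → x ∈ xs → g x ≡ h x
map-≡⇒≡-on-∈ g h (y ∷ xs) eq (here refl) = ∷-injectiveˡ eq
map-≡⇒≡-on-∈ g h (y ∷ xs) eq (there x∈) = map-≡⇒≡-on-∈ g h xs (∷-injectiveʳ eq) x∈

downward-induction : (P : ℕ → Set) {k : ℕ} → (∀ {t} → t < k → P (suc t) → P t) → P k →
  ∀ {t} → t ≤ k → P t
downward-induction P {k} step Pk {t} t≤k = go (k ∸ t) (m+[n∸m]≡n t≤k)
  where
    go : ∀ {t} d → t + d ≡ k → P t
    go {t} zero    t+0≡k = subst P (trans (sym t+0≡k) (+-identityʳ t)) Pk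
    go {t} (suc d) t+d≡k = step (subst (t <_) t+d≡k (m<m+n t z<s)) (go d (trans (sym (+-suc t d)) t+d≡k))

pigeonhole-∈ : (u : ℕ → A) (L : List A) {k : ℕ} → length L ≤ k → (∀ {t} → t ≤ k → u t ∈ L) →
  ∃₂ λ s t → s < t × t ≤ k × u s ≡ u t
pigeonhole-∈ u L {k} |L|≤k u∈L =
  let i , j , i<j , same = pigeonhole (s≤s |L|≤k) (index ∘ member) in
  toℕ i , toℕ j , i<j , s≤s⁻¹ (toℕ<n j) ,
    trans (lookup-index (member i)) (trans (cong (lookup L) same) (sym (lookup-index (member j))))
  where
    member : (i : Fin (suc k)) → u (toℕ i) ∈ L
    member i = u∈L (s≤s⁻¹ (toℕ<n i))

module _ (h : A → A) (u : ℕ → A) {k : ℕ} (step : ∀ {t} → t < k → u (suc t) ≡ h (u t)) where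

  repetition-propagates : ∀ {s t} d → s < t → t + d ≤ k → u s ≡ u t → u (s + d) ≡ u (t + d)
  repetition-propagates {s} {t} zero    _   _       same
    rewrite +-identityʳ s | +-identityʳ t = same
  repetition-propagates {s} {t} (suc d) s<t t+d<k same = begin
    u (s + suc d)   ≡⟨ cong u (+-suc s d) ⟩
    u (suc (s + d)) ≡⟨ step (<-trans (+-monoˡ-< d s<t) t+d<k') ⟩
    h (u (s + d))   ≡⟨ cong h (repetition-propagates d s<t (<⇒≤ t+d<k') same) ⟩
    h (u (t + d))   ≡⟨ sym (step t+d<k') ⟩
    u (suc (t + d)) ≡⟨ cong u (sym (+-suc t d)) ⟩
    u (t + suc d)   ∎
    where
      open ≡-Reasoning
      t+d<k' : t + d < k
      t+d<k' = subst (_≤ k) (+-suc t d) t+d<k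

  last-value-recurs : (L : List A) → length L ≤ k → (∀ {t} → t ≤ k → u t ∈ L) →
    ∃ λ i → i < k × u i ≡ u k
  last-value-recurs L |L|≤k u∈L
    with s , t , s<t , t≤k , same ← pigeonhole-∈ u L |L|≤k u∈L
    = s + (k ∸ t)
    , subst (s + (k ∸ t) <_) t+[k∸t]≡k (+-monoˡ-< (k ∸ t) s<t)
    , trans (repetition-propagates (k ∸ t) s<t (≤-reflexive t+[k∸t]≡k) same) (cong u t+[k∸t]≡k)
    where
      t+[k∸t]≡k : t + (k ∸ t) ≡ k
      t+[k∸t]≡k = m+[n∸m]≡n t≤k

actChar : (Π ↔ Π) → Char Σ Π → Char Σ Π
actChar f = Sum.map id (Inverse.to f)

IsParameter : Maybe (Char Σ Π) → Set
IsParameter {Σ} {Π} c = ∃ λ (y : Π) → c ≡ just (inj₂ y)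

IsParameter-actChar⁻ : (f : Π ↔ Π) (c : Maybe (Char Σ Π)) →
  IsParameter (Maybe.map (actChar f) c) → IsParameter c
IsParameter-actChar⁻ f (just (inj₂ y)) _       = y , refl
IsParameter-actChar⁻ f (just (inj₁ _)) (_ , ())
IsParameter-actChar⁻ f nothing         (_ , ())

∈⇒∈-params : (w : PString Σ Π) {y : Π} → inj₂ y ∈ w → y ∈ params w
∈⇒∈-params (inj₂ _ ∷ w) (here refl) = here refl
∈⇒∈-params (inj₁ _ ∷ w) (there y∈)  = ∈⇒∈-params w y∈
∈⇒∈-params (inj₂ _ ∷ w) (there y∈)  = there (∈⇒∈-params w y∈)

∈⇒∈-paramSet : (_≟_ : DecidableEquality Π) (w : PString Σ Π) {y : Π} → inj₂ y ∈ w → y ∈ paramSet _≟_ w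
∈⇒∈-paramSet _≟_ w y∈ = ∈-deduplicate⁺ _≟_ (∈⇒∈-params w y∈)

period-shift : (f : Π ↔ Π) (w : PString Σ Π) (p : ℕ) {m i : ℕ} → act f (take m w) ≡ drop p w → i < m →
  w ! (p + i) ≡ Maybe.map (actChar f) (w ! i)
period-shift f w p {m} {i} period i<m = begin
  w ! (p + i)                             ≡⟨ sym (!-drop w p i) ⟩
  drop p w ! i                            ≡⟨ cong (_! i) (sym period) ⟩
  act f (take m w) ! i                    ≡⟨ !-map (actChar f) (take m w) i ⟩
  Maybe.map (actChar f) (take m w ! i)    ≡⟨ cong (Maybe.map (actChar f)) (!-take w i<m) ⟩
  Maybe.map (actChar f) (w ! i)           ∎
  where open ≡-Reasoning

module BorderParameter (_≟_ : DecidableEquality Π) (f : Π ↔ Π) (w : PString Σ Π) {p : ℕ} .{{_ : NonZero p}}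
  (period : act f (take (length w ∸ p) w) ≡ drop p w)
  (room : p * numParams _≟_ w ≤ length w ∸ p) where

  private
    m = length w ∸ p
    k = numParams _≟_ w

    -- room makes the subtraction exact, so that pos k = m.
    pos : ℕ → ℕ
    pos t = (m ∸ p * k) + p * t

    pos-last : pos k ≡ m
    pos-last = m∸n+n≡m room

    pos-<m : ∀ {t} → t < k → pos t < m
    pos-<m {t} t<k = subst (pos t <_) pos-last (+-monoʳ-< (m ∸ p * k) (*-monoʳ-< p t<k))

    pos-suc : ∀ t → pos (suc t) ≡ p + pos t
    pos-suc t = trans (cong (m ∸ p * k +_) (*-suc p t)) (x∙yz≈y∙xz (m ∸ p * k) p (p * t))

    u : ℕ → Maybe (Char Σ Π)
    u t = w ! pos t

    u-step : ∀ {t} → t < k → u (suc t) ≡ Maybe.map (actChar f) (u t)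
    u-step {t} t<k = trans (cong (w !_) (pos-suc t)) (period-shift f w p period (pos-<m t<k))

    parameters : List (Maybe (Char Σ Π))
    parameters = map (just ∘ inj₂) (paramSet _≟_ w)

    u∈parameters : ∀ {t} → IsParameter (u t) → u t ∈ parameters
    u∈parameters {t} (y , ut≡y) =
      subst (_∈ parameters) (sym ut≡y) (∈-map⁺ (just ∘ inj₂) (∈⇒∈-paramSet _≟_ w (!⇒∈ w (pos t) ut≡y)))

  border-parameter-occurs-before : ∀ {y} → w ! m ≡ just (inj₂ y) → inj₂ y ∈ take m w
  border-parameter-occurs-before {y} border =
    let i , i<k , ui≡uk = last-value-recurs (Maybe.map (actChar f)) u u-step parameters
                            (≤-reflexive (length-map (just ∘ inj₂) (paramSet _≟_ w))) (u∈parameters ∘ u-parameter)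
    in !⇒∈ (take m w) (pos i) (trans (!-take w (pos-<m i<k)) (trans ui≡uk uk≡y))
    where
      uk≡y : u k ≡ just (inj₂ y)
      uk≡y = trans (cong (w !_) pos-last) border

      u-parameter : ∀ {t} → t ≤ k → IsParameter (u t)
      u-parameter = downward-induction (IsParameter ∘ u)
        (λ {t} t<k → IsParameter-actChar⁻ f (u t) ∘ subst IsParameter (u-step t<k)) (y , uk≡y)

slice-suffix : (w : List A) (p : ℕ) → slice w p (length w) ≡ drop p w
slice-suffix w p = take-all (length w ∸ p) (drop p w) (≤-reflexive (length-drop p w))

module _ (w : PString Σ Π) {p : ℕ} {x : Char Σ Π} (p≤n : p ≤ length w)
  (border : w ! (length w ∸ p) ≡ just x) where

  private
    m = length w ∸ p

    slice-prefix-∷ʳ : ∀ b → slice (w ∷ʳ b) 0 (length (w ∷ʳ b) ∸ p) ≡ take m w ∷ʳ x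
    slice-prefix-∷ʳ b = trans (cong (λ j → take j (w ∷ʳ b)) (length-∷ʳ-∸ w b p≤n)) (take-suc-++ w m [ b ] border)

    slice-suffix-∷ʳ : ∀ b → slice (w ∷ʳ b) p (length (w ∷ʳ b)) ≡ drop p w ∷ʳ b
    slice-suffix-∷ʳ b = trans (slice-suffix (w ∷ʳ b) p) (drop-++ˡ w [ b ] p≤n)

  period-extends : 1 ≤ p → (f : Π ↔ Π) → act f (take m w) ≡ drop p w → IsPeriod p (w ∷ʳ actChar f x)
  period-extends 1≤p f period = 1≤p , p≤n+1 , f , (begin
    act f (slice (w ∷ʳ b) 0 (length (w ∷ʳ b) ∸ p)) ≡⟨ cong (act f) (slice-prefix-∷ʳ b) ⟩
    act f (take m w ∷ʳ x)                          ≡⟨ map-++ (actChar f) (take m w) [ x ] ⟩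
    act f (take m w) ∷ʳ b                          ≡⟨ cong (_∷ʳ b) period ⟩
    drop p w ∷ʳ b                                  ≡⟨ sym (slice-suffix-∷ʳ b) ⟩
    slice (w ∷ʳ b) p (length (w ∷ʳ b))             ∎)
    where
      open ≡-Reasoning
      b = actChar f x
      p≤n+1 : p ≤ length (w ∷ʳ b)
      p≤n+1 = ≤-trans p≤n (subst (length w ≤_) (sym (length-++ w)) (m≤m+n (length w) 1))

  extended-period-witness : ∀ {b} → IsPeriod p (w ∷ʳ b) →
    ∃ λ g → act g (take m w) ≡ drop p w × actChar g x ≡ b
  extended-period-witness {b} (_ , _ , g , period) = g , ∷ʳ-injective (act g (take m w)) (drop p w) (begin
    act g (take m w) ∷ʳ actChar g x                ≡⟨ sym (map-++ (actChar g) (take m w) [ x ]) ⟩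
    act g (take m w ∷ʳ x)                          ≡⟨ cong (act g) (sym (slice-prefix-∷ʳ b)) ⟩
    act g (slice (w ∷ʳ b) 0 (length (w ∷ʳ b) ∸ p)) ≡⟨ period ⟩
    slice (w ∷ʳ b) p (length (w ∷ʳ b))             ≡⟨ slice-suffix-∷ʳ b ⟩
    drop p w ∷ʳ b                                  ∎)
    where open ≡-Reasoning

witnesses-agree-at-border : (_≟_ : DecidableEquality Π) (w : PString Σ Π) {p : ℕ} .{{_ : NonZero p}} →
  p * numParams _≟_ w ≤ length w ∸ p → (f g : Π ↔ Π) →
  act f (take (length w ∸ p) w) ≡ drop p w → act g (take (length w ∸ p) w) ≡ drop p w →
  ∀ {x} → w ! (length w ∸ p) ≡ just x → actChar g x ≡ actChar f x
witnesses-agree-at-border _≟_ w room f g f-period g-period {inj₁ _} _      = refl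
witnesses-agree-at-border _≟_ w room f g f-period g-period {inj₂ _} border =
  map-≡⇒≡-on-∈ (actChar g) (actChar f) _ (trans g-period (sym f-period))
    (BorderParameter.border-parameter-occurs-before _≟_ f w f-period room border)

lemma6 : (Σ Π : Set) (_≟_ : DecidableEquality Π) (w : PString Σ Π) (p : ℕ) →
    IsPeriod p w →
    p * (numParams _≟_ w + 1) ≤ length w →
    ∃ λ (a : Char Σ Π) → IsPeriod p (w ++ [ a ]) ×
    ((b : Char Σ Π) → IsPeriod p (w ++ [ b ]) → b ≡ a)
lemma6 Σ Π _≟_ w p (1≤p , p≤n , f , period) bound
  with x , border ← <-length⇒!-defined w (∸-monoʳ-< {o = 0} 1≤p p≤n) =
  actChar f x , period-extends w p≤n border 1≤p f f-period , λ b b-period →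
    let g , g-period , gx≡b = extended-period-witness w p≤n border b-period
    in trans (sym gx≡b) (witnesses-agree-at-border _≟_ w {{>-nonZero 1≤p}} room f g f-period g-period border)
  where
    k = numParams _≟_ w

    f-period : act f (take (length w ∸ p) w) ≡ drop p w
    f-period = trans period (slice-suffix w p)

    p*[k+1]≡p*k+p : p * (k + 1) ≡ p * k + p
    p*[k+1]≡p*k+p = trans (*-distribˡ-+ p k 1) (cong (p * k +_) (*-identityʳ p))

    room : p * k ≤ length w ∸ p
    room = m+n≤o⇒m≤o∸n (p * k) (subst (_≤ length w) p*[k+1]≡p*k+p bound)
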